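{- Let $P$ be an $a \times b$ $0$-$1$ matrix whose bottom-left entry $P_{a,1}$ and top-right entry $P_{1,b}$ are both $1$. Let $R$ be the $(2a-1)\times(2b-1)$ $0$-$1$ matrix obtained by joining two copies of $P$ so that the top-right corner of one copy coincides with the bottom-left corner of the other: namely $R_{i,j} = P_{i-a+1,\,j}$ for $a \le i \le 2a-1$, $1 \le j \le b$; $R_{i,j} = P_{i,\,j-b+1}$ for $1 \le i \le a$, $b \le j \le 2b-1$; and $R_{i,j}=0$ elsewhere. Then for every $m$, $sm(m,P) \leq sm(m,R) \leq 2\,sm(m,P)$.
   Context: A $0$-$1$ matrix $A$ contains a $0$-$1$ matrix $P$ if some submatrix of $A$ (obtained by selecting a subset of rows and a subset of columns, preserving order) either equals $P$ or can be changed into $P$ by turning some ones into zeroes; otherwise $A$ avoids $P$. For $0$-$1$ matrices $A, P$, $LSM(A,P)$ is the maximum number of ones in a $P$-avoiding $0$-$1$ matrix $B$ that is contained in $A$. $sm(m,P)$ is the minimum of $LSM(A,P)$ over all $0$-$1$ matrices $A$ with exactly $m$ ones. -}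

module Defs where

open import Data.Nat using (ℕ; zero; suc; _+_; _*_; _∸_; _≤_; _<_; _<?_; _≤ᵇ_)
open import Data.Fin as F using (Fin; toℕ; fromℕ<)
open import Data.Bool using (Bool; true; false; if_then_else_; _∧_)
open import Data.Product using (Σ; ∃; _×_; _,_)
open import Relation.Nullary using (¬_; yes; no)
open import Relation.Binary.PropositionalEquality using (_≡_)

-- A 0-1 matrix with r rows and c columns (0-indexed), entries Bool (true = 1).
Matrix : ℕ → ℕ → Set
Matrix r c = Fin r → Fin c → Bool

countRow : ∀ {n} → (Fin n → Bool) → ℕ
countRow {zero}  v = 0
countRow {suc n} v = (if v F.zero then 1 else 0) + countRow (λ j → v (F.suc j))

ones : ∀ {r c} → Matrix r c → ℕ
ones {zero}  M = 0
ones {suc r} M = countRow (M F.zero) + ones (λ i → M (F.suc i))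

StrictlyIncreasing : ∀ {n k} → (Fin n → Fin k) → Set
StrictlyIncreasing f = ∀ i j → i F.< j → f i F.< f j

Contains : ∀ {r c a b} → Matrix r c → Matrix a b → Set
Contains {r} {c} {a} {b} A P =
  Σ (Fin a → Fin r) λ f → Σ (Fin b → Fin c) λ g →
    StrictlyIncreasing f × StrictlyIncreasing g ×
    (∀ i j → P i j ≡ true → A (f i) (g j) ≡ true)

Avoids : ∀ {r c a b} → Matrix r c → Matrix a b → Set
Avoids A P = ¬ Contains A P

-- IsLSM A P k : k = LSM(A,P), the maximum number of ones in a P-avoiding
-- 0-1 matrix B (of any dimensions) contained in A.
IsLSM : ∀ {r c a b} → Matrix r c → Matrix a b → ℕ → Set
IsLSM {r} {c} A P k =
  (Σ ℕ λ r' → Σ ℕ λ c' → Σ (Matrix r' c') λ B →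
     Contains A B × Avoids B P × ones B ≡ k)
  × (∀ {r' c'} (B : Matrix r' c') → Contains A B → Avoids B P → ones B ≤ k)

-- IsSm m P s : s = sm(m,P), the minimum of LSM(A,P) over all 0-1 matrices A
-- (of any dimensions) with exactly m ones.
IsSm : ∀ {a b} → ℕ → Matrix a b → ℕ → Set
IsSm m P s =
  (Σ ℕ λ r → Σ ℕ λ c → Σ (Matrix r c) λ A → ones A ≡ m × IsLSM A P s)
  × (∀ {r c} (A : Matrix r c) → ones A ≡ m → ∀ k → IsLSM A P k → s ≤ k)

-- entry lookup with natural-number (0-based) indices; false out of range
entry : ∀ {r c} → Matrix r c → ℕ → ℕ → Bool
entry {r} {c} M i j with i <? r | j <? c
... | yes i<r | yes j<c = M (fromℕ< i<r) (fromℕ< j<c)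
... | _       | _       = false

-- For P of size (a+1) × (b+1), R of size (2a+1) × (2b+1):
-- (0-based) rows a..2a, cols 0..b : lower-left copy  R i j = P (i-a) j
--           rows 0..a,  cols b..2b: upper-right copy R i j = P i (j-b)
-- zero elsewhere. (Paper's 1-based R_{i,j}=P_{i-a+1,j}, R_{i,j}=P_{i,j-b+1}.)
joinCorner : ∀ {a b} → Matrix (suc a) (suc b) → Matrix (suc (a + a)) (suc (b + b))
joinCorner {a} {b} P i j =
  if (a ≤ᵇ toℕ i) ∧ (toℕ j ≤ᵇ b) then entry P (toℕ i ∸ a) (toℕ j)
  else if (toℕ i ≤ᵇ a) ∧ (b ≤ᵇ toℕ j) then entry P (toℕ i) (toℕ j ∸ b)
  else false

module Submission where

-- Both inequalities follow from one principle (sm-≤-bound): sm(m,Q) ≤ N as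
-- soon as some matrix A with m ones has only Q-avoiding submatrices with at
-- most N ones.  Since R contains P, every P-avoiding submatrix avoids R,
-- which gives sm(m,P) ≤ sm(m,R).  For the other inequality, an R-avoiding
-- matrix B splits into the ones that are the top-right corner of some copy
-- of P in B, and the others; both parts avoid P (R-free-split), so B has at
-- most 2 LSM(A,P) ones.  The splitting uses a copy-gluing construction
-- (glueCopies): two copies of P meeting corner to corner form a copy of R.
--
-- Existence of the maxima LSM and the decidability of "being a corner" are
-- obtained classically, under a double negation; this is harmless because
-- the goals are decidable inequalities between natural numbers.

open import Defs
open import Data.Nat using (ℕ; suc; _≤_; _*_)
open import Data.Fin using (Fin; zero; fromℕ)
open import Data.Bool using (Bool; true)
open import Data.Product using (_×_)
open import Relation.Binary.PropositionalEquality using (_≡_)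

open import Data.Nat using (zero; _+_; _∸_; _<_; _≤?_; _≤ᵇ_; z≤n; s≤s; s<s; s<s⁻¹)
open import Data.Nat.Properties
open import Algebra.Properties.CommutativeSemigroup +-commutativeSemigroup using (interchange)
open import Data.Fin as F using (toℕ; fromℕ<; splitAt; _↑ˡ_)
open import Data.Fin.Properties
  using (toℕ-injective; toℕ<n; toℕ≤pred[n]; fromℕ<-toℕ; toℕ-fromℕ<; toℕ-fromℕ; toℕ-↑ˡ; splitAt⁻¹-↑ˡ; splitAt⁻¹-↑ʳ; toℕ-↑ʳ)
open import Data.Bool using (false; if_then_else_; _∧_; not; T)
open import Data.Bool.Properties using (T-∧; T-≡)
open import Data.Sum using (_⊎_; inj₁; inj₂; [_,_]′)
open import Data.Product using (Σ; ∃; _,_; proj₁; proj₂)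
open import Function using (_∘_; Equivalence)
open import Relation.Nullary using (¬_; Dec; yes; no; does; contradiction)
open import Relation.Nullary.Decidable using (decidable-stable; ¬¬-excluded-middle)
open import Relation.Nullary.Negation using (¬¬-map)
open import Relation.Binary.PropositionalEquality using (_≢_; refl; sym; trans; cong; cong₂; subst; subst₂; module ≡-Reasoning)

private
  variable
    r c r′ c′ : ℕ

¬¬-∀-Fin : ∀ n {X : Fin n → Set} → (∀ i → ¬ ¬ X i) → ¬ ¬ (∀ i → X i)
¬¬-∀-Fin zero    _ refute = refute (λ ())
¬¬-∀-Fin (suc n) h refute =
  h zero λ x₀ → ¬¬-∀-Fin n (h ∘ F.suc) λ xs → refute λ { zero → x₀ ; (F.suc i) → xs i }

¬¬-decide-positions : (S : Fin r → Fin c → Set) → ¬ ¬ (∀ i j → Dec (S i j))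
¬¬-decide-positions {r} {c} S =
  ¬¬-∀-Fin r λ i → ¬¬-∀-Fin c λ j → ¬¬-excluded-middle

IsMaximum : (ℕ → Set) → ℕ → Set
IsMaximum Q k = Q k × (∀ j → Q j → j ≤ k)

¬¬-maximum : (Q : ℕ → Set) → ∀ d k → Q k → (∀ j → Q j → j ≤ d + k) → ¬ ¬ ∃ (IsMaximum Q)
¬¬-maximum Q zero    k qk bound refute = refute (k , qk , bound)
¬¬-maximum Q (suc d) k qk bound refute = ¬¬-excluded-middle {A = Σ ℕ λ j → Q j × k < j} λ
  { (yes (j , qj , k<j)) → ¬¬-maximum Q d j qj (λ i qi → ≤-trans (bound i qi) (gap-shrinks k<j)) refute
  ; (no none) → refute (k , qk , λ j qj → ≮⇒≥ (λ k<j → none (j , qj , k<j))) }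
  where
    gap-shrinks : ∀ {j} → k < j → suc d + k ≤ d + j
    gap-shrinks {j} k<j = subst (_≤ d + j) (+-suc d k) (+-monoʳ-≤ d k<j)

count : Bool → ℕ
count b = if b then 1 else 0

countRow-+ : ∀ {n} (v x y : Fin n → Bool) → (∀ j → count (v j) ≡ count (x j) + count (y j)) →
  countRow v ≡ countRow x + countRow y
countRow-+ {zero}  _ _ _ _ = refl
countRow-+ {suc n} v x y h =
  trans (cong₂ _+_ (h zero) (countRow-+ (v ∘ F.suc) (x ∘ F.suc) (y ∘ F.suc) (h ∘ F.suc)))
        (interchange (count (x zero)) (count (y zero)) _ _)

ones-+ : (M X Y : Matrix r c) → (∀ i j → count (M i j) ≡ count (X i j) + count (Y i j)) →
  ones M ≡ ones X + ones Y
ones-+ {zero}  _ _ _ _ = refl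
ones-+ {suc r} M X Y h =
  trans (cong₂ _+_ (countRow-+ (M zero) (X zero) (Y zero) (h zero))
                   (ones-+ (M ∘ F.suc) (X ∘ F.suc) (Y ∘ F.suc) (h ∘ F.suc)))
        (interchange (countRow (X zero)) (countRow (Y zero)) _ _)

_⊆_ : Matrix r c → Matrix r c → Set
X ⊆ Y = ∀ i j → X i j ≡ true → Y i j ≡ true

module _ {S : Fin r → Fin c → Set} (M : Matrix r c) (S? : ∀ i j → Dec (S i j)) where

  inside : Matrix r c
  inside i j = M i j ∧ does (S? i j)

  outside : Matrix r c
  outside i j = M i j ∧ not (does (S? i j))

  ones-inside-outside : ones M ≡ ones inside + ones outside
  ones-inside-outside = ones-+ M inside outside λ i j → split (M i j) (does (S? i j))
    where
      split : ∀ x y → count x ≡ count (x ∧ y) + count (x ∧ not y)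
      split false _     = refl
      split true  false = refl
      split true  true  = refl

  inside-true : ∀ i j → inside i j ≡ true → M i j ≡ true × S i j
  inside-true i j = select (M i j) (S? i j)
    where
      select : ∀ {Q} x (d : Dec Q) → x ∧ does d ≡ true → x ≡ true × Q
      select true (yes q) _ = refl , q

  outside-true : ∀ i j → outside i j ≡ true → M i j ≡ true × ¬ S i j
  outside-true i j = select (M i j) (S? i j)
    where
      select : ∀ {Q} x (d : Dec Q) → x ∧ not (does d) ≡ true → x ≡ true × ¬ Q
      select true (no ¬q) _ = refl , ¬q

  inside-⊆ : inside ⊆ M
  inside-⊆ i j = proj₁ ∘ inside-true i j

  outside-⊆ : outside ⊆ M
  outside-⊆ i j = proj₁ ∘ outside-true i j

contains-⊆-pattern : ∀ {a b} {A : Matrix r c} {X Y : Matrix a b} → X ⊆ Y → Contains A Y → Contains A X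
contains-⊆-pattern X⊆Y (f , g , sf , sg , h) = f , g , sf , sg , λ i j → h i j ∘ X⊆Y i j

contains-⊆-host : ∀ {a b} {X Y : Matrix r c} {P : Matrix a b} → X ⊆ Y → Contains X P → Contains Y P
contains-⊆-host X⊆Y (f , g , sf , sg , h) = f , g , sf , sg , λ i j → X⊆Y (f i) (g j) ∘ h i j

contains-trans : ∀ {a b a′ b′} {A : Matrix r c} {B : Matrix a b} {C : Matrix a′ b′} →
  Contains A B → Contains B C → Contains A C
contains-trans (f , g , sf , sg , h) (f′ , g′ , sf′ , sg′ , h′) =
  f ∘ f′ , g ∘ g′ ,
  (λ i j → sf (f′ i) (f′ j) ∘ sf′ i j) , (λ i j → sg (g′ i) (g′ j) ∘ sg′ i j) ,
  λ i j → h (f′ i) (g′ j) ∘ h′ i j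

Achievable : ∀ {a b} → Matrix r c → Matrix a b → ℕ → Set
Achievable A Q k = Σ ℕ λ r′ → Σ ℕ λ c′ → Σ (Matrix r′ c′) λ B → Contains A B × Avoids B Q × ones B ≡ k

-- The empty matrix avoids every nonempty pattern, so 0 is always achievable.
achievable-0 : ∀ {a b} (A : Matrix r c) (Q : Matrix (suc a) (suc b)) → Achievable A Q 0
achievable-0 A Q = 0 , 0 , (λ ()) , ((λ ()) , (λ ()) , (λ ()) , (λ ()) , (λ ())) , empty-avoids , refl
  where
    empty-avoids : Avoids {0} {0} (λ ()) Q
    empty-avoids (f , _) with f zero
    ... | ()

¬¬-LSM : ∀ {a b} (A : Matrix r c) (Q : Matrix (suc a) (suc b)) N →
  (∀ {r′ c′} (B : Matrix r′ c′) → Contains A B → Avoids B Q → ones B ≤ N) →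
  ¬ ¬ (Σ ℕ λ k → IsLSM A Q k × k ≤ N)
¬¬-LSM A Q N bound = ¬¬-map isLSM
  (¬¬-maximum (Achievable A Q) N 0 (achievable-0 A Q) λ j achj → subst (j ≤_) (sym (+-identityʳ N)) (achievable-≤ achj))
  where
    achievable-≤ : ∀ {j} → Achievable A Q j → j ≤ N
    achievable-≤ (_ , _ , B , AB , BQ , refl) = bound B AB BQ
    isLSM : ∃ (IsMaximum (Achievable A Q)) → Σ ℕ λ k → IsLSM A Q k × k ≤ N
    isLSM (k , achk , maximal) =
      k , (achk , λ B AB BQ → maximal (ones B) (_ , _ , B , AB , BQ , refl)) , achievable-≤ achk

sm-≤-bound : ∀ {a b m s N} {Q : Matrix (suc a) (suc b)} → IsSm m Q s →
  (A : Matrix r c) → ones A ≡ m →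
  (∀ {r′ c′} (B : Matrix r′ c′) → Contains A B → Avoids B Q → ones B ≤ N) → s ≤ N
sm-≤-bound {s = s} {N} {Q} (_ , minimal) A onesA bound =
  decidable-stable (s ≤? N) (¬¬-map (λ { (k , lsm , k≤N) → ≤-trans (minimal A onesA k lsm) k≤N }) (¬¬-LSM A Q N bound))

increasing-monotone : ∀ {m n} {f : Fin m → Fin n} → StrictlyIncreasing f →
  ∀ p q → toℕ p ≤ toℕ q → toℕ (f p) ≤ toℕ (f q)
increasing-monotone {f = f} f-inc p q p≤q with m≤n⇒m<n∨m≡n p≤q
... | inj₁ p<q = <⇒≤ (f-inc p q p<q)
... | inj₂ p≡q = ≤-reflexive (cong (toℕ ∘ f) (toℕ-injective p≡q))

module Concat {n a : ℕ} (u v : Fin (suc a) → Fin n)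
              (u-inc : StrictlyIncreasing u) (v-inc : StrictlyIncreasing v)
              (meet : u (fromℕ a) ≡ v zero) where

  concat : Fin (suc (a + a)) → Fin n
  concat i = [ u , v ∘ F.suc ]′ (splitAt (suc a) i)

  data Part (i : Fin (suc (a + a))) : Set where
    first  : (p : Fin (suc a)) → toℕ i ≡ toℕ p → concat i ≡ u p → Part i
    second : (q : Fin a) → toℕ i ≡ suc (a + toℕ q) → concat i ≡ v (F.suc q) → Part i

  part : ∀ i → Part i
  part i with splitAt (suc a) i in eq
  ... | inj₁ p = first p (trans (cong toℕ (sym (splitAt⁻¹-↑ˡ eq))) (toℕ-↑ˡ p a)) (cong [ u , v ∘ F.suc ]′ eq)
  ... | inj₂ q = second q (trans (cong toℕ (sym (splitAt⁻¹-↑ʳ eq))) (toℕ-↑ʳ (suc a) q)) (cong [ u , v ∘ F.suc ]′ eq)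

  not-beyond : (p : Fin (suc a)) → ∀ {x} → a < x → toℕ p ≢ x
  not-beyond p a<x = <⇒≢ (≤-<-trans (toℕ≤pred[n] p) a<x)

  concat-first : ∀ i p → toℕ i ≡ toℕ p → concat i ≡ u p
  concat-first i p ip with part i
  ... | first p′ ip′ wp = trans wp (cong u (toℕ-injective (trans (sym ip′) ip)))
  ... | second q iq _ = contradiction (trans (sym ip) iq) (not-beyond p (s≤s (m≤m+n a (toℕ q))))

  concat-second : ∀ i p → toℕ i ≡ toℕ p + a → concat i ≡ v p
  concat-second i zero ip = trans (concat-first i (fromℕ a) (trans ip (sym (toℕ-fromℕ a)))) meet
  concat-second i (F.suc p) ip with part i
  ... | first p′ ip′ _ = contradiction (trans (sym ip′) ip) (not-beyond p′ (s≤s (m≤n+m a (toℕ p))))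
  ... | second q iq wq = trans wq (cong (v ∘ F.suc) (toℕ-injective q≡p))
    where
      q≡p : toℕ q ≡ toℕ p
      q≡p = +-cancelˡ-≡ a _ _ (trans (suc-injective (trans (sym iq) ip)) (+-comm (toℕ p) a))

  -- every value of u is below the values of v past the meeting point:
  -- u p ≤ u a = v 0 < v (q + 1)
  u-before-v : ∀ p q → u p F.< v (F.suc q)
  u-before-v p q =
    ≤-<-trans (increasing-monotone u-inc p (fromℕ a) (subst (toℕ p ≤_) (sym (toℕ-fromℕ a)) (toℕ≤pred[n] p)))
              (subst (λ z → z F.< v (F.suc q)) (sym meet) (v-inc zero (F.suc q) (s≤s z≤n)))

  ordered : ∀ i j {x y} → concat i ≡ x → concat j ≡ y → x F.< y → concat i F.< concat j
  ordered _ _ refl refl x<y = x<y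

  concat-increasing : StrictlyIncreasing concat
  concat-increasing i j i<j with part i | part j
  ... | first p ip wp | first q jq wq = ordered i j wp wq (u-inc p q (subst₂ _<_ ip jq i<j))
  ... | second p ip wp | second q jq wq =
        ordered i j wp wq (v-inc (F.suc p) (F.suc q) (s<s (+-cancelˡ-< a _ _ (s<s⁻¹ (subst₂ _<_ ip jq i<j)))))
  ... | first p _ wp | second q _ wq = ordered i j wp wq (u-before-v p q)
  ... | second p ip _ | first q jq _ =
        contradiction (sym jq) (not-beyond q (<-trans (subst (a <_) (sym ip) (s≤s (m≤m+n a (toℕ p)))) i<j))

entry-toℕ : (M : Matrix r c) (p : Fin r) (q : Fin c) → entry M (toℕ p) (toℕ q) ≡ M p q
entry-toℕ {r} {c} M p q with toℕ p <? r | toℕ q <? c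
... | yes p<r | yes q<c = cong₂ M (fromℕ<-toℕ p p<r) (fromℕ<-toℕ q q<c)
... | no p≮r  | _       = contradiction (toℕ<n p) p≮r
... | yes _   | no q≮c  = contradiction (toℕ<n q) q≮c

entry-true : (M : Matrix r c) → ∀ i j → entry M i j ≡ true →
  Σ (Fin r) λ p → Σ (Fin c) λ q → toℕ p ≡ i × toℕ q ≡ j × M p q ≡ true
entry-true {r} {c} M i j e with i <? r | j <? c
entry-true M i j e  | yes i<r | yes j<c = fromℕ< i<r , fromℕ< j<c , toℕ-fromℕ< i<r , toℕ-fromℕ< j<c , e
entry-true M i j () | no _    | _
entry-true M i j () | yes _   | no _

if-taken : ∀ {b} {x y : Bool} → b ≡ true → (if b then x else y) ≡ x
if-taken refl = refl

if-true : ∀ b {x y : Bool} → (if b then x else y) ≡ true → (T b × x ≡ true) ⊎ y ≡ true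
if-true true  e = inj₁ (_ , e)
if-true false e = inj₂ e

module JoinCorner {a b : ℕ} (P : Matrix (suc a) (suc b)) where

  R : Matrix (suc (a + a)) (suc (b + b))
  R = joinCorner P

  R-lowerLeft : ∀ i j p q → toℕ i ≡ toℕ p + a → toℕ j ≡ toℕ q → R i j ≡ P p q
  R-lowerLeft i j p q ip jq = begin
    R i j                                     ≡⟨ if-taken inLowerLeft ⟩
    entry P (toℕ i ∸ a) (toℕ j)               ≡⟨ cong₂ (entry P) (trans (cong (_∸ a) ip) (m+n∸n≡m (toℕ p) a)) jq ⟩
    entry P (toℕ p) (toℕ q)                   ≡⟨ entry-toℕ P p q ⟩
    P p q                                     ∎
    where
      open ≡-Reasoning
      inLowerLeft : (a ≤ᵇ toℕ i) ∧ (toℕ j ≤ᵇ b) ≡ true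
      inLowerLeft = Equivalence.to T-≡ (Equivalence.from T-∧
        (≤⇒≤ᵇ (subst (a ≤_) (sym ip) (m≤n+m a (toℕ p))) , ≤⇒≤ᵇ (subst (_≤ b) (sym jq) (toℕ≤pred[n] q))))

  R-contains-P : Contains R P
  R-contains-P = shift , (_↑ˡ b) ,
    (λ p p′ p<p′ → subst₂ _<_ (sym (toℕ-fromℕ< _)) (sym (toℕ-fromℕ< _)) (+-monoˡ-< a p<p′)) ,
    (λ q q′ q<q′ → subst₂ _<_ (sym (toℕ-↑ˡ q b)) (sym (toℕ-↑ˡ q′ b)) q<q′) ,
    λ p q e → trans (R-lowerLeft (shift p) (q ↑ˡ b) p q (toℕ-fromℕ< _) (toℕ-↑ˡ q b)) e
    where
      shift : Fin (suc a) → Fin (suc (a + a))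
      shift p = fromℕ< (s≤s (+-monoˡ-≤ a (toℕ≤pred[n] p)))

  avoids-P⇒avoids-R : (B : Matrix r c) → Avoids B P → Avoids B R
  avoids-P⇒avoids-R B B-avoids-P B-contains-R = B-avoids-P (contains-trans {A = B} B-contains-R R-contains-P)

  LowerLeftOne UpperRightOne : Fin (suc (a + a)) → Fin (suc (b + b)) → Set
  LowerLeftOne  i j = Σ (Fin (suc a)) λ p → Σ (Fin (suc b)) λ q →
    toℕ i ≡ toℕ p + a × toℕ j ≡ toℕ q × P p q ≡ true
  UpperRightOne i j = Σ (Fin (suc a)) λ p → Σ (Fin (suc b)) λ q →
    toℕ i ≡ toℕ p × toℕ j ≡ toℕ q + b × P p q ≡ true

  R-true : ∀ i j → R i j ≡ true → LowerLeftOne i j ⊎ UpperRightOne i j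
  R-true i j e with if-true ((a ≤ᵇ toℕ i) ∧ (toℕ j ≤ᵇ b)) e
  ... | inj₁ (inLL , e′) with entry-true P (toℕ i ∸ a) (toℕ j) e′
  ...   | p , q , pi , qj , pq =
          inj₁ (p , q , trans (sym (m∸n+n≡m a≤i)) (cong (_+ a) (sym pi)) , sym qj , pq)
    where
      a≤i : a ≤ toℕ i
      a≤i = ≤ᵇ⇒≤ a (toℕ i) (proj₁ (Equivalence.to T-∧ inLL))
  R-true i j e | inj₂ e′ with if-true ((toℕ i ≤ᵇ a) ∧ (b ≤ᵇ toℕ j)) e′
  ... | inj₁ (inUR , e″) with entry-true P (toℕ i) (toℕ j ∸ b) e″
  ...   | p , q , pi , qj , pq =
          inj₂ (p , q , sym pi , trans (sym (m∸n+n≡m b≤j)) (cong (_+ b) (sym qj)) , pq)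
    where
      b≤j : b ≤ toℕ j
      b≤j = ≤ᵇ⇒≤ b (toℕ j) (proj₂ (Equivalence.to T-∧ inUR))
  R-true i j e | inj₂ e′ | inj₂ ()

  rowsOf : (B : Matrix r c) → Contains B P → Fin (suc a) → Fin r
  rowsOf B (f , _) = f

  colsOf : (B : Matrix r c) → Contains B P → Fin (suc b) → Fin c
  colsOf B (_ , g , _) = g

  glueCopies : (B : Matrix r c) (lowerLeft upperRight : Contains B P) →
    rowsOf B lowerLeft zero ≡ rowsOf B upperRight (fromℕ a) →
    colsOf B lowerLeft (fromℕ b) ≡ colsOf B upperRight zero →
    Contains B R
  glueCopies B (f₁ , g₁ , f₁-inc , g₁-inc , h₁) (f₂ , g₂ , f₂-inc , g₂-inc , h₂) rowMeet colMeet =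
    Rows.concat , Cols.concat , Rows.concat-increasing , Cols.concat-increasing , ones-covered
    where
      module Rows = Concat f₂ f₁ f₂-inc f₁-inc (sym rowMeet)
      module Cols = Concat g₁ g₂ g₁-inc g₂-inc colMeet
      ones-covered : ∀ i j → R i j ≡ true → B (Rows.concat i) (Cols.concat j) ≡ true
      ones-covered i j e with R-true i j e
      ... | inj₁ (p , q , ip , jq , pq) =
            subst₂ (λ x y → B x y ≡ true) (sym (Rows.concat-second i p ip)) (sym (Cols.concat-first j q jq)) (h₁ p q pq)
      ... | inj₂ (p , q , ip , jq , pq) =
            subst₂ (λ x y → B x y ≡ true) (sym (Rows.concat-first i p ip)) (sym (Cols.concat-second j q jq)) (h₂ p q pq)

module Splitting {a b : ℕ} (P : Matrix (suc a) (suc b))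
                 (P-bottomLeft : P (fromℕ a) zero ≡ true) (P-topRight : P zero (fromℕ b) ≡ true) where

  open JoinCorner P

  TopRightCorner : (B : Matrix r c) → Fin r → Fin c → Set
  TopRightCorner B i j = Σ (Contains B P) λ κ → rowsOf B κ zero ≡ i × colsOf B κ (fromℕ b) ≡ j

  -- If B avoids R, both the corner ones of B and the remaining ones avoid P:
  -- a copy of P among the corner ones has its bottom-left corner at the
  -- top-right corner of another copy, and the two glue to a copy of R; a copy
  -- of P among the other ones would have its own top-right corner there.
  R-free-split : (B : Matrix r c) → Avoids B R → (corner? : ∀ i j → Dec (TopRightCorner B i j)) →
    Avoids (inside B corner?) P × Avoids (outside B corner?) P
  R-free-split B B-avoids-R corner? = corners-avoid , others-avoid
    where
      corners-avoid : Avoids (inside B corner?) P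
      corners-avoid κ@(f , g , _ , _ , h)
        with inside-true B corner? (f (fromℕ a)) (g zero) (h (fromℕ a) zero P-bottomLeft)
      ... | _ , (κ′ , rowMeet , colMeet) =
        B-avoids-R (glueCopies B κ′ (contains-⊆-host (inside-⊆ B corner?) κ) rowMeet colMeet)

      others-avoid : Avoids (outside B corner?) P
      others-avoid κ@(f , g , _ , _ , h) =
        proj₂ (outside-true B corner? (f zero) (g (fromℕ b)) (h zero (fromℕ b) P-topRight))
          (contains-⊆-host (outside-⊆ B corner?) κ , refl , refl)

  R-free-bound : ∀ {s} (A : Matrix r c) →
    (∀ {r′ c′} (B : Matrix r′ c′) → Contains A B → Avoids B P → ones B ≤ s) →
    ∀ {r′ c′} (B : Matrix r′ c′) → Contains A B → Avoids B R → ones B ≤ 2 * s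
  R-free-bound {s = s} A P-free-bound {r′} {c′} B A-contains-B B-avoids-R =
    decidable-stable (ones B ≤? 2 * s) (¬¬-map bound (¬¬-decide-positions (TopRightCorner B)))
    where
      part-bound : (X : Matrix r′ c′) → X ⊆ B → Avoids X P → ones X ≤ s
      part-bound X X⊆B = P-free-bound X (contains-⊆-pattern {A = A} X⊆B A-contains-B)

      bound : (∀ i j → Dec (TopRightCorner B i j)) → ones B ≤ 2 * s
      bound corner? with R-free-split B B-avoids-R corner?
      ... | corners-avoid , others-avoid = begin
        ones B                                             ≡⟨ ones-inside-outside B corner? ⟩
        ones (inside B corner?) + ones (outside B corner?) ≤⟨ +-mono-≤ (part-bound _ (inside-⊆ B corner?) corners-avoid)
                                                                        (part-bound _ (outside-⊆ B corner?) others-avoid) ⟩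
        s + s                                              ≡⟨ cong (s +_) (sym (+-identityʳ s)) ⟩
        2 * s                                              ∎
        where open ≤-Reasoning

mainTheorem6 : ∀ {a b} (P : Matrix (suc a) (suc b)) →
    P (fromℕ a) zero ≡ true → P zero (fromℕ b) ≡ true →
    ∀ m s t → IsSm m P s → IsSm m (joinCorner P) t →
    s ≤ t × t ≤ 2 * s
mainTheorem6 P P-bottomLeft P-topRight m s t
             smP@((_ , _ , A , onesA , _ , LSM[A,P]-bound) , _)
             smR@((_ , _ , A′ , onesA′ , _ , LSM[A′,R]-bound) , _) =
  -- A′ has m ones and LSM(A′,R) = t; its P-avoiding submatrices avoid R,
  -- so they have at most t ones
  sm-≤-bound smP A′ onesA′ (λ B A′B → LSM[A′,R]-bound B A′B ∘ avoids-P⇒avoids-R B) ,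
  -- A has m ones and LSM(A,P) = s; its R-avoiding submatrices have at most 2s ones
  sm-≤-bound smR A onesA (R-free-bound A LSM[A,P]-bound)
  where
    open JoinCorner P using (avoids-P⇒avoids-R)
    open Splitting P P-bottomLeft P-topRight using (R-free-bound)
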